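{- Let $\alpha$ be a finite (possibly empty) sequence of positive integers, $\beta$ a non-empty finite sequence of positive integers, and $d\ge 0$ an integer. Let $G=\alpha\circledcirc\beta,(2d+1)$ be the mis\`ere \textsc{cricket pitch} position with the bumps of $\alpha$ to the left of the roller and, to its right, the bumps of $\beta$ followed by one further (outermost) bump of size $2d+1$. Then $o(G)=o(\alpha\circledcirc\beta)$.
   Context: \textsc{cricket pitch}: a position is a finite row of bumps (non-negative integers) with one roller placed between two bumps or at one end; $\circledcirc$ denotes the roller. Left moves the roller to the left over any positive number of consecutive bumps; Right moves it to the right over any positive number of consecutive bumps. Each bump rolled over is reduced by $1$. A bump of value $0$ is no longer a bump and can no longer be rolled over. Mis\`ere play: the player who cannot move on their turn wins. $o(\cdot)$ denotes the outcome class: $\mathcal{L}$ (Left wins whoever moves first), $\mathcal{R}$ (Right wins whoever moves first), $\mathcal{N}$ (the player moving first wins), $\mathcal{P}$ (the player moving second wins). -}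

module Defs where

open import Data.Nat using (ℕ; zero; suc; _+_; _*_)
open import Data.List using (List; []; _∷_; reverse; _++_; [_])
open import Data.Product using (Σ; _×_; _,_)
open import Data.Sum using (_⊎_)
open import Relation.Nullary using (¬_)

-- A cricket pitch position: the bumps to the left and to the right of the
-- roller, each list ordered NEAREST TO THE ROLLER FIRST.  A 0 entry is a
-- flattened bump: it is no longer a bump and cannot be rolled over (it blocks).
record Pos : Set where
  constructor ⟨_∣_⟩
  field
    near-left  : List ℕ
    near-right : List ℕ

-- Roll src dst src' dst' : the roller moves over a positive number of
-- consecutive (positive) bumps taken from the front of src; each is reduced
-- by 1 and placed (in order) onto the front of dst, the other side.
data Roll : List ℕ → List ℕ → List ℕ → List ℕ → Set where
  stop : ∀ {b xs ys} → Roll (suc b ∷ xs) ys xs (b ∷ ys)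
  more : ∀ {b xs ys xs' ys'} → Roll xs (b ∷ ys) xs' ys' →
         Roll (suc b ∷ xs) ys xs' ys'

LeftMove : Pos → Pos → Set
LeftMove ⟨ l ∣ r ⟩ ⟨ l' ∣ r' ⟩ = Roll l r l' r'

RightMove : Pos → Pos → Set
RightMove ⟨ l ∣ r ⟩ ⟨ l' ∣ r' ⟩ = Roll r l r' l'

-- Misère play: the player unable to move on their turn wins.
-- LeftSecond G : Left, with Right to move in G, has a winning strategy.
-- (Inductive, i.e. winning in finitely many moves; all plays are finite.)
data LeftFirst  : Pos → Set
data LeftSecond : Pos → Set

data LeftFirst where
  noMove : ∀ {G} → (∀ G' → ¬ LeftMove G G') → LeftFirst G
  play   : ∀ {G} G' → LeftMove G G' → LeftSecond G' → LeftFirst G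

data LeftSecond where
  allRespond : ∀ {G} → (Σ Pos λ G' → RightMove G G') →
               (∀ G' → RightMove G G' → LeftFirst G') → LeftSecond G

data RightFirst  : Pos → Set
data RightSecond : Pos → Set

data RightFirst where
  noMove : ∀ {G} → (∀ G' → ¬ RightMove G G') → RightFirst G
  play   : ∀ {G} G' → RightMove G G' → RightSecond G' → RightFirst G

data RightSecond where
  allRespond : ∀ {G} → (Σ Pos λ G' → LeftMove G G') →
               (∀ G' → LeftMove G G' → RightFirst G') → RightSecond G

data Outcome : Set where
  𝓛 𝓡 𝓝 𝓟 : Outcome

-- o(G) ≡ c  is rendered as  HasOutcome G c.
HasOutcome : Pos → Outcome → Set
HasOutcome G 𝓛 = LeftFirst G × LeftSecond G
HasOutcome G 𝓡 = RightFirst G × RightSecond G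
HasOutcome G 𝓝 = LeftFirst G × RightFirst G
HasOutcome G 𝓟 = LeftSecond G × RightSecond G

-- The position  α ⊚ β  with α, β written left to right.
_⊚_ : List ℕ → List ℕ → Pos
α ⊚ β = ⟨ reverse α ∣ β ⟩

-- The outermost bump 2d+1 can only be reached by Right, by rolling over
-- every bump of β and then over it.  That leaves Left to move with the
-- roller at the right end and a bump of even size 2d next to it; Right has
-- no bumps left, so the two players are forced to roll this single bump
-- back and forth until it is flat on Left's turn, and Left wins.  Hence this
-- extra Right move is always losing and can be ignored, while every other
-- move of either player corresponds to the same move in α ⊚ β.
module Submission where

open import Defs
open import Data.Nat using (ℕ; zero; suc; _*_; _<_)
open import Data.Nat.Properties using (*-suc)
open import Data.List using (List; []; _∷_; _++_; [_]; reverse)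
open import Data.List.Relation.Unary.All using (All)
open import Data.Product using (_×_; _,_; ∃-syntax)
open import Data.Sum using (_⊎_; inj₁; inj₂)
open import Data.Empty using (⊥; ⊥-elim)
open import Function.Bundles using (_⇔_; mk⇔)
open import Relation.Binary.PropositionalEquality using (_≡_; _≢_; refl)
open import Relation.Nullary using (¬_)

LeftFirst⇒¬RightSecond : ∀ {G} → LeftFirst G → RightSecond G → ⊥
LeftSecond⇒¬RightFirst : ∀ {G} → LeftSecond G → RightFirst G → ⊥

LeftFirst⇒¬RightSecond (noMove stuck) (allRespond (G' , mv) _) = stuck G' mv
LeftFirst⇒¬RightSecond (play G' mv ls) (allRespond _ rf) =
  LeftSecond⇒¬RightFirst ls (rf G' mv)

LeftSecond⇒¬RightFirst (allRespond (G' , mv) _) (noMove stuck) = stuck G' mv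
LeftSecond⇒¬RightFirst (allRespond _ lf) (play G' mv rs) =
  LeftFirst⇒¬RightSecond (lf G' mv) rs

-- ≈ᴸ relates positions with Left to move, ≈ᴿ positions with Right to move.
-- G may have extra Right moves, as long as each one loses for Right and H has
-- some Right move.
module Simulation
  (_≈ᴸ_ _≈ᴿ_ : Pos → Pos → Set)
  (left-sim : ∀ {G H G'} → G ≈ᴸ H → LeftMove G G' →
              ∃[ H' ] (LeftMove H H' × G' ≈ᴿ H'))
  (left-sim⁻ : ∀ {G H H'} → G ≈ᴸ H → LeftMove H H' →
               ∃[ G' ] (LeftMove G G' × G' ≈ᴿ H'))
  (right-sim : ∀ {G H G'} → G ≈ᴿ H → RightMove G G' →
               ∃[ H' ] (RightMove H H' × G' ≈ᴸ H') ⊎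
               (LeftFirst G' × ∃[ H' ] RightMove H H'))
  (right-sim⁻ : ∀ {G H H'} → G ≈ᴿ H → RightMove H H' →
                ∃[ G' ] (RightMove G G' × G' ≈ᴸ H'))
  where

  right-move-exists : ∀ {G H G'} → G ≈ᴿ H → RightMove G G' → ∃[ H' ] RightMove H H'
  right-move-exists G≈H mv with right-sim G≈H mv
  ... | inj₁ (H' , mv′ , _) = H' , mv′
  ... | inj₂ (_ , move)     = move

  leftFirst⁺   : ∀ {G H} → G ≈ᴸ H → LeftFirst G → LeftFirst H
  leftFirst⁻   : ∀ {G H} → G ≈ᴸ H → LeftFirst H → LeftFirst G
  rightSecond⁺ : ∀ {G H} → G ≈ᴸ H → RightSecond G → RightSecond H
  rightSecond⁻ : ∀ {G H} → G ≈ᴸ H → RightSecond H → RightSecond G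
  leftSecond⁺  : ∀ {G H} → G ≈ᴿ H → LeftSecond G → LeftSecond H
  leftSecond⁻  : ∀ {G H} → G ≈ᴿ H → LeftSecond H → LeftSecond G
  rightFirst⁺  : ∀ {G H} → G ≈ᴿ H → RightFirst G → RightFirst H
  rightFirst⁻  : ∀ {G H} → G ≈ᴿ H → RightFirst H → RightFirst G

  leftFirst⁺ G≈H (noMove stuck) =
    noMove λ H' mv → let G' , mv′ , _ = left-sim⁻ G≈H mv in stuck G' mv′
  leftFirst⁺ G≈H (play G' mv ls) =
    let H' , mv′ , G'≈H' = left-sim G≈H mv in play H' mv′ (leftSecond⁺ G'≈H' ls)

  leftFirst⁻ G≈H (noMove stuck) =
    noMove λ G' mv → let H' , mv′ , _ = left-sim G≈H mv in stuck H' mv′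
  leftFirst⁻ G≈H (play H' mv ls) =
    let G' , mv′ , G'≈H' = left-sim⁻ G≈H mv in play G' mv′ (leftSecond⁻ G'≈H' ls)

  rightSecond⁺ G≈H (allRespond (G' , mv) rf) =
    let H' , mv′ , _ = left-sim G≈H mv in
    allRespond (H' , mv′) λ H' mv →
      let G' , mv′ , G'≈H' = left-sim⁻ G≈H mv in rightFirst⁺ G'≈H' (rf G' mv′)

  rightSecond⁻ G≈H (allRespond (H' , mv) rf) =
    let G' , mv′ , _ = left-sim⁻ G≈H mv in
    allRespond (G' , mv′) λ G' mv →
      let H' , mv′ , G'≈H' = left-sim G≈H mv in rightFirst⁻ G'≈H' (rf H' mv′)

  leftSecond⁺ G≈H (allRespond (G' , mv) lf) =
    allRespond (right-move-exists G≈H mv) λ H' mv →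
      let G' , mv′ , G'≈H' = right-sim⁻ G≈H mv in leftFirst⁺ G'≈H' (lf G' mv′)

  leftSecond⁻ {G} G≈H (allRespond (H' , mv) lf) =
    let G' , mv′ , _ = right-sim⁻ G≈H mv in
    allRespond (G' , mv′) respond
    where
      respond : ∀ G' → RightMove G G' → LeftFirst G'
      respond G' mv with right-sim G≈H mv
      ... | inj₁ (H' , mv′ , G'≈H') = leftFirst⁻ G'≈H' (lf H' mv′)
      ... | inj₂ (left-wins , _)    = left-wins

  rightFirst⁺ G≈H (noMove stuck) =
    noMove λ H' mv → let G' , mv′ , _ = right-sim⁻ G≈H mv in stuck G' mv′
  rightFirst⁺ G≈H (play G' mv rs) with right-sim G≈H mv
  ... | inj₁ (H' , mv′ , G'≈H') = play H' mv′ (rightSecond⁺ G'≈H' rs)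
  ... | inj₂ (left-wins , _)    = ⊥-elim (LeftFirst⇒¬RightSecond left-wins rs)

  rightFirst⁻ G≈H (noMove stuck) =
    noMove λ G' mv → let H' , mv′ = right-move-exists G≈H mv in stuck H' mv′
  rightFirst⁻ G≈H (play H' mv rs) =
    let G' , mv′ , G'≈H' = right-sim⁻ G≈H mv in play G' mv′ (rightSecond⁻ G'≈H' rs)

  hasOutcome-⇔ : ∀ {G H} → G ≈ᴸ H → G ≈ᴿ H → ∀ c → HasOutcome G c ⇔ HasOutcome H c
  hasOutcome-⇔ G≈ᴸH G≈ᴿH 𝓛 = mk⇔ (λ (p , q) → leftFirst⁺ G≈ᴸH p , leftSecond⁺ G≈ᴿH q)
                              (λ (p , q) → leftFirst⁻ G≈ᴸH p , leftSecond⁻ G≈ᴿH q)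
  hasOutcome-⇔ G≈ᴸH G≈ᴿH 𝓡 = mk⇔ (λ (p , q) → rightFirst⁺ G≈ᴿH p , rightSecond⁺ G≈ᴸH q)
                              (λ (p , q) → rightFirst⁻ G≈ᴿH p , rightSecond⁻ G≈ᴸH q)
  hasOutcome-⇔ G≈ᴸH G≈ᴿH 𝓝 = mk⇔ (λ (p , q) → leftFirst⁺ G≈ᴸH p , rightFirst⁺ G≈ᴿH q)
                              (λ (p , q) → leftFirst⁻ G≈ᴸH p , rightFirst⁻ G≈ᴿH q)
  hasOutcome-⇔ G≈ᴸH G≈ᴿH 𝓟 = mk⇔ (λ (p , q) → leftSecond⁺ G≈ᴿH p , rightSecond⁺ G≈ᴸH q)
                              (λ (p , q) → leftSecond⁻ G≈ᴿH p , rightSecond⁻ G≈ᴸH q)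

roll-target-nonempty : ∀ {xs ys xs'} → ¬ Roll xs ys xs' []
roll-target-nonempty (more mv) = roll-target-nonempty mv

roll-++ˡ : ∀ {xs ys xs' ys'} t → Roll xs ys xs' ys' → Roll (xs ++ t) ys (xs' ++ t) ys'
roll-++ˡ t stop      = stop
roll-++ˡ t (more mv) = more (roll-++ˡ t mv)

roll-++ʳ : ∀ {xs ys xs' ys'} t → Roll xs ys xs' ys' → Roll xs (ys ++ t) xs' (ys' ++ t)
roll-++ʳ t stop      = stop
roll-++ʳ t (more mv) = more (roll-++ʳ t mv)

roll-++ʳ⁻ : ∀ {xs ys xs' zs} t → Roll xs (ys ++ t) xs' zs →
            ∃[ ys' ] (Roll xs ys xs' ys' × zs ≡ ys' ++ t)
roll-++ʳ⁻ t stop = _ , stop , refl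
roll-++ʳ⁻ t (more mv) =
  let ys' , mv′ , eq = roll-++ʳ⁻ t mv in ys' , more mv′ , eq

roll-∷ʳ⁻ : ∀ {x xs ys zs ws} n → Roll (x ∷ xs ++ [ suc n ]) ys zs ws →
           ∃[ xs' ] (Roll (x ∷ xs) ys xs' ws × zs ≡ xs' ++ [ suc n ]) ⊎
           ∃[ ws' ] (Roll (x ∷ xs) ys [] ws' × zs ≡ [] × ws ≡ n ∷ ws')
roll-∷ʳ⁻ {xs = []}    n stop               = inj₁ ([] , stop , refl)
roll-∷ʳ⁻ {xs = []}    n (more stop)        = inj₂ (_ , stop , refl , refl)
roll-∷ʳ⁻ {xs = []}    n (more (more ()))
roll-∷ʳ⁻ {xs = _ ∷ _} n stop               = inj₁ (_ , stop , refl)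
roll-∷ʳ⁻ {xs = _ ∷ _} n (more mv) with roll-∷ʳ⁻ n mv
... | inj₁ (xs' , mv′ , eq)      = inj₁ (xs' , more mv′ , eq)
... | inj₂ (ws' , mv′ , eq , eq′) = inj₂ (ws' , more mv′ , eq , eq′)

leftFirst-even-bump : ∀ k l → LeftFirst ⟨ 2 * k ∷ l ∣ [] ⟩
leftSecond-odd-bump : ∀ k l → LeftSecond ⟨ l ∣ [ suc (2 * k) ] ⟩

leftFirst-even-bump zero    l = noMove λ { ⟨ _ ∣ _ ⟩ () }
leftFirst-even-bump (suc k) l rewrite *-suc 2 k =
  play ⟨ l ∣ [ suc (2 * k) ] ⟩ stop (leftSecond-odd-bump k l)

leftSecond-odd-bump k l = allRespond (⟨ 2 * k ∷ l ∣ [] ⟩ , stop) λ where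
  ⟨ _ ∣ _ ⟩ stop        → leftFirst-even-bump k l
  ⟨ _ ∣ _ ⟩ (more ())

module OuterBump (k : ℕ) where

  outer : List ℕ
  outer = [ suc (2 * k) ]

  data _≈ᴸ_ : Pos → Pos → Set where
    extend : ∀ l r → ⟨ l ∣ r ++ outer ⟩ ≈ᴸ ⟨ l ∣ r ⟩

  -- With no bump between the roller and the outer bump, Right would have a
  -- move in the extended position only, so the right side must be non-empty.
  data _≈ᴿ_ : Pos → Pos → Set where
    extend : ∀ l x r → ⟨ l ∣ x ∷ r ++ outer ⟩ ≈ᴿ ⟨ l ∣ x ∷ r ⟩

  after-left-move : ∀ {l r a b} → Roll l r a b → ⟨ a ∣ b ++ outer ⟩ ≈ᴿ ⟨ a ∣ b ⟩
  after-left-move {b = []}    mv = ⊥-elim (roll-target-nonempty mv)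
  after-left-move {b = x ∷ r} mv = extend _ x r

  left-sim : ∀ {G H G'} → G ≈ᴸ H → LeftMove G G' → ∃[ H' ] (LeftMove H H' × G' ≈ᴿ H')
  left-sim {G' = ⟨ a ∣ _ ⟩} (extend l r) mv with roll-++ʳ⁻ outer mv
  ... | b , mv′ , refl = ⟨ a ∣ b ⟩ , mv′ , after-left-move mv′

  left-sim⁻ : ∀ {G H H'} → G ≈ᴸ H → LeftMove H H' → ∃[ G' ] (LeftMove G G' × G' ≈ᴿ H')
  left-sim⁻ {H' = ⟨ a ∣ b ⟩} (extend l r) mv =
    ⟨ a ∣ b ++ outer ⟩ , roll-++ʳ outer mv , after-left-move mv

  right-sim : ∀ {G H G'} → G ≈ᴿ H → RightMove G G' →
              ∃[ H' ] (RightMove H H' × G' ≈ᴸ H') ⊎ (LeftFirst G' × ∃[ H' ] RightMove H H')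
  right-sim {G' = ⟨ a ∣ _ ⟩} (extend l x r) mv with roll-∷ʳ⁻ (2 * k) mv
  ... | inj₁ (b , mv′ , refl)         = inj₁ (⟨ a ∣ b ⟩ , mv′ , extend a b)
  ... | inj₂ (l' , mv′ , refl , refl) = inj₂ (leftFirst-even-bump k l' , ⟨ l' ∣ [] ⟩ , mv′)

  right-sim⁻ : ∀ {G H H'} → G ≈ᴿ H → RightMove H H' → ∃[ G' ] (RightMove G G' × G' ≈ᴸ H')
  right-sim⁻ {H' = ⟨ a ∣ b ⟩} (extend l x r) mv =
    ⟨ a ∣ b ++ outer ⟩ , roll-++ˡ outer mv , extend a b

  open Simulation _≈ᴸ_ _≈ᴿ_ left-sim left-sim⁻ right-sim right-sim⁻ public

lemma2 : (α β : List ℕ) (d : ℕ) → All (0 <_) α → All (0 <_) β → β ≢ [] →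
    (c : Outcome) → HasOutcome (α ⊚ (β ++ [ suc (2 * d) ])) c ⇔ HasOutcome (α ⊚ β) c
lemma2 α []      d _ _ β≢[] c = ⊥-elim (β≢[] refl)
lemma2 α (x ∷ r) d _ _ _    c =
  hasOutcome-⇔ (extend (reverse α) (x ∷ r)) (extend (reverse α) x r) c
  where open OuterBump d
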